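{- For all integers $n$ and $t$ with $n \geq 3$ and $2 \leq 2t < n$, the double generalized Petersen graph $\mathrm{DP}(n,t)$ is Hamiltonian, i.e., it contains a cycle passing through every vertex exactly once.
   Context: Let $\mathbb{Z}_n = \mathbb{Z}/n\mathbb{Z}$. For integers $n \geq 3$ and $t$ with $2 \leq 2t < n$, the double generalized Petersen graph $\mathrm{DP}(n,t)$ is the undirected simple graph with vertex set $V = \{x_i, u_i, v_i, y_i \mid i \in \mathbb{Z}_n\}$ and edge set $E = \{x_ix_{i+1},\ y_iy_{i+1},\ x_iu_i,\ y_iv_i,\ u_iv_{i+t},\ v_iu_{i+t} \mid i \in \mathbb{Z}_n\}$, where indices are taken modulo $n$. -}

module Defs where

open import Data.Nat using (ℕ; suc; _+_; _%_; NonZero)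
open import Data.Nat.DivMod using (m%n<n)
open import Data.Fin using (Fin; toℕ; fromℕ<)
open import Data.Product using (_×_; _,_)
open import Data.Sum using (_⊎_)
open import Data.List using (List; head; last)
open import Data.List.Relation.Unary.Unique.Propositional using (Unique)
open import Data.List.Relation.Unary.Linked using (Linked)
open import Data.List.Membership.Propositional using (_∈_)
open import Data.Maybe using (Maybe; just)
open import Relation.Binary.PropositionalEquality using (_≡_)

data Kind : Set where
  X U V Y : Kind

Vertex : ℕ → Set
Vertex n = Kind × Fin n

add : (n : ℕ) → .{{_ : NonZero n}} → Fin n → ℕ → Fin n
add n i k = fromℕ< (m%n<n (toℕ i + k) n)

data Gen (n t : ℕ) .{{_ : NonZero n}} : Vertex n → Vertex n → Set where
  xx : ∀ i → Gen n t (X , i) (X , add n i 1)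
  yy : ∀ i → Gen n t (Y , i) (Y , add n i 1)
  xu : ∀ i → Gen n t (X , i) (U , i)
  yv : ∀ i → Gen n t (Y , i) (V , i)
  uv : ∀ i → Gen n t (U , i) (V , add n i t)
  vu : ∀ i → Gen n t (V , i) (U , add n i t)

Adj : (n t : ℕ) → .{{_ : NonZero n}} → Vertex n → Vertex n → Set
Adj n t a b = Gen n t a b ⊎ Gen n t b a

record HamiltonianCycle (n t : ℕ) .{{_ : NonZero n}} : Set where
  field
    cycle    : List (Vertex n)
    unique   : Unique cycle
    covers   : (w : Vertex n) → w ∈ cycle
    linked   : Linked (Adj n t) cycle
    closeA   : Vertex n
    closeB   : Vertex n
    headEq   : head cycle ≡ just closeA
    lastEq   : last cycle ≡ just closeB
    closing  : Adj n t closeB closeA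

Hamiltonian : (n t : ℕ) → .{{_ : NonZero n}} → Set
Hamiltonian n t = HamiltonianCycle n t

-- In the coordinates v′ a = v (a + t), y′ a = y (a + t), DP(n,t) consists of two n-cycles, the
-- x-rim and the y′-rim, joined by the spokes x a ─ u a ─ v′ a ─ y′ a, together with the chords
-- v′ a ─ u (a + 2t). For even n rims and spokes suffice: the cycle zig-zags through consecutive
-- pairs of spokes. For odd n chords are needed. If n = 2t + 1 the chord v′ (a + 1) ─ u a is local
-- and a similar zig-zag works, with one detour through u 0. Otherwise n = 2e + 3 + 2(M + 1)t with
-- e < t; the chords link u a, v′ a, u (a + 2t), v′ (a + 2t), … into columns of M + 1 or M + 2
-- rows, and the cycle runs along the y′-rim, sweeps the columns 2e + 2, …, 2t up and down (a comb),
-- returns along the x-rim and sweeps the columns 1, …, 2e + 1 in the same way. In every case the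
-- cycle is a list of length 4n through all vertices, hence without repetitions.
module Submission where

open import Defs
open import Data.Fin using (Fin; toℕ; fromℕ<)
import Data.Fin.Properties as Fin
open import Data.List using (List; []; _∷_; _++_; [_]; length; map; reverse; filter; head; last; allFin; cartesianProduct)
import Data.List.Properties as List
open import Data.List.Membership.Propositional using (_∈_; _∉_)
open import Data.List.Membership.Propositional.Properties using (∈-filter⁺; ∈-filter⁻; ∈-++⁺ˡ; ∈-++⁺ʳ)
open import Data.List.Relation.Binary.Subset.Propositional using (_⊆_)
open import Data.List.Relation.Binary.Subset.Propositional.Properties using (⊆-trans; xs⊆xs++ys; xs⊆ys++xs)
import Data.List.Relation.Unary.All as All
open import Data.List.Relation.Unary.All using ([]; _∷_)
open import Data.List.Relation.Unary.AllPairs using ([]; _∷_)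
import Data.List.Relation.Unary.Any as Any
open import Data.List.Relation.Unary.Any using (here; there)
open import Data.List.Relation.Unary.Any.Properties using (reverse⁺)
open import Data.List.Relation.Unary.Linked using (Linked; [-]; _∷_)
open import Data.List.Relation.Unary.Unique.Propositional using (Unique)
import Data.List.Relation.Unary.Unique.Propositional.Properties as Unique
open import Data.Maybe using (just)
open import Data.Nat using (ℕ; zero; suc; _+_; _*_; _%_; _/_; _∸_; _≤_; _<_; _≤?_; z≤n; s≤s; s≤s⁻¹; NonZero)
import Data.Nat as ℕ
open import Data.Nat.DivMod using (m%n<n; m≡m%n+[m/n]*n; [m+n]%n≡m%n; [m+kn]%n≡m%n; %-distribˡ-+; m%n%n≡m%n; m<n⇒m%n≡m; m%n≤n)
open import Data.Nat.Properties
open import Data.Nat.Tactic.RingSolver using (solve-∀)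
import Data.Product.Properties as Product
open import Data.Product using (_×_; _,_; proj₁; proj₂; ∃)
open import Data.Sum using (_⊎_; inj₁; inj₂)
open import Relation.Binary.Definitions using (DecidableEquality; tri<; tri≈; tri>)
open import Relation.Binary.PropositionalEquality hiding ([_])
open import Relation.Nullary.Decidable using (yes; no; ¬?; map′)
open import Relation.Nullary.Negation using (contradiction)
open import Function using (_∘′_)

module _ {A : Set} (_≟_ : DecidableEquality A) where

  private
    _without_ : List A → A → List A
    xs without a = filter (λ z → ¬? (a ≟ z)) xs

  Unique-⊆⇒length≤ : ∀ {xs ys} → Unique xs → xs ⊆ ys → length xs ≤ length ys
  Unique-⊆⇒length≤ {[]} _ _ = z≤n
  Unique-⊆⇒length≤ {x ∷ xs} {ys} (x≢xs ∷ !xs) x∷xs⊆ys = begin-strict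
    length xs             ≤⟨ Unique-⊆⇒length≤ !xs xs⊆ys-x ⟩
    length (ys without x) <⟨ List.filter-notAll _ ys (Any.map (λ x≡z x≢z → x≢z x≡z) (x∷xs⊆ys (here refl))) ⟩
    length ys             ∎
    where
    open ≤-Reasoning
    xs⊆ys-x : xs ⊆ ys without x
    xs⊆ys-x z∈xs = ∈-filter⁺ _ (x∷xs⊆ys (there z∈xs)) (All.lookup x≢xs z∈xs)

  ⊆-length≤⇒Unique : ∀ {xs ys} → Unique ys → ys ⊆ xs → length xs ≤ length ys → Unique xs
  ⊆-length≤⇒Unique {[]} _ _ _ = []
  ⊆-length≤⇒Unique {x ∷ xs} {ys} !ys ys⊆x∷xs |x∷xs|≤|ys| =
    All.tabulate (λ { z∈xs refl → x∉xs z∈xs })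
    ∷ ⊆-length≤⇒Unique (Unique.filter⁺ _ !ys) ys-x⊆xs
        (s≤s⁻¹ (≤-trans |x∷xs|≤|ys| (Unique-⊆⇒length≤ !ys ys⊆x∷ys-x)))
    where
    x∉xs : x ∉ xs
    x∉xs x∈xs = <⇒≱ |x∷xs|≤|ys| (Unique-⊆⇒length≤ !ys ys⊆xs)
      where
      ys⊆xs : ys ⊆ xs
      ys⊆xs z∈ys with ys⊆x∷xs z∈ys
      ... | here refl  = x∈xs
      ... | there z∈xs = z∈xs

    ys-x⊆xs : ys without x ⊆ xs
    ys-x⊆xs z∈ with ∈-filter⁻ _ z∈
    ... | z∈ys , x≢z with ys⊆x∷xs z∈ys
    ...   | here z≡x   = contradiction (sym z≡x) x≢z
    ...   | there z∈xs = z∈xs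

    ys⊆x∷ys-x : ys ⊆ x ∷ ys without x
    ys⊆x∷ys-x {z} z∈ys with x ≟ z
    ... | yes refl = here refl
    ... | no x≢z   = there (∈-filter⁺ _ z∈ys x≢z)

length-cartesianProduct : ∀ {A B : Set} (xs : List A) (ys : List B) →
                          length (cartesianProduct xs ys) ≡ length xs * length ys
length-cartesianProduct []       ys = refl
length-cartesianProduct (x ∷ xs) ys = begin
  length (map (x ,_) ys ++ cartesianProduct xs ys)        ≡⟨ List.length-++ (map (x ,_) ys) ⟩
  length (map (x ,_) ys) + length (cartesianProduct xs ys) ≡⟨ cong₂ _+_ (List.length-map (x ,_) ys) (length-cartesianProduct xs ys) ⟩
  length ys + length xs * length ys                        ∎
  where open ≡-Reasoning

length-++-≡ : ∀ {A : Set} (xs : List A) {ys m n} → length xs ≡ m → length ys ≡ n → length (xs ++ ys) ≡ m + n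
length-++-≡ xs |xs| |ys| = trans (List.length-++ xs) (cong₂ _+_ |xs| |ys|)

data Parity : ℕ → Set where
  even : ∀ k → Parity (k + k)
  odd  : ∀ k → Parity (suc (k + k))

parity : ∀ a → Parity a
parity zero = even zero
parity (suc a) with parity a
... | even k = odd k
... | odd k  = subst Parity (cong suc (+-suc k k)) (even (suc k))

double-suc : ∀ k → suc k + suc k ≡ suc (suc (k + k))
double-suc k = cong suc (+-suc k k)

+-suc-suc : ∀ m k → m + suc (suc k) ≡ suc (suc (m + k))
+-suc-suc m k = trans (+-suc m (suc k)) (cong suc (+-suc m k))

+-suc-suc-double : ∀ q k → q + (suc k + suc k) ≡ suc (suc (q + (k + k)))
+-suc-suc-double q k = trans (cong (q +_) (double-suc k)) (+-suc-suc q (k + k))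

m+m<n+n⇒m<n : ∀ {m n} → m + m < n + n → m < n
m+m<n+n⇒m<n lt = ≰⇒> (λ n≤m → <⇒≱ lt (+-mono-≤ n≤m n≤m))

m+m≤n+n⇒m≤n : ∀ {m n} → m + m ≤ n + n → m ≤ n
m+m≤n+n⇒m≤n le = ≮⇒≥ (λ n<m → <⇒≱ (+-mono-< n<m n<m) le)

data Cut (b : ℕ) : ℕ → Set where
  below : ∀ {a} → a ≤ b → Cut b a
  above : ∀ d → Cut b (suc (b + d))

cut : ∀ b a → Cut b a
cut b a with a ≤? b
... | yes a≤b = below a≤b
... | no a≰b with m≤n⇒∃[o]m+o≡n (≰⇒> a≰b)
...   | d , refl = above d

data Around (b : ℕ) : ℕ → Set where
  before : ∀ {a} → a < b → Around b a
  at     : Around b b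
  after  : ∀ d → Around b (suc (b + d))

around : ∀ b a → Around b a
around b a with <-cmp a b
... | tri< a<b _ _  = before a<b
... | tri≈ _ refl _ = at
... | tri> _ _ b<a with m≤n⇒∃[o]m+o≡n b<a
...   | d , refl = after d

toℕᴷ : Kind → ℕ
toℕᴷ X = 0
toℕᴷ U = 1
toℕᴷ V = 2
toℕᴷ Y = 3

fromℕᴷ : ℕ → Kind
fromℕᴷ 0 = X
fromℕᴷ 1 = U
fromℕᴷ 2 = V
fromℕᴷ _ = Y

fromℕᴷ-toℕᴷ : ∀ k → fromℕᴷ (toℕᴷ k) ≡ k
fromℕᴷ-toℕᴷ X = refl
fromℕᴷ-toℕᴷ U = refl
fromℕᴷ-toℕᴷ V = refl
fromℕᴷ-toℕᴷ Y = refl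

_≟ᴷ_ : DecidableEquality Kind
k ≟ᴷ l = map′ toℕᴷ-injective (cong toℕᴷ) (toℕᴷ k ℕ.≟ toℕᴷ l)
  where
  toℕᴷ-injective : toℕᴷ k ≡ toℕᴷ l → k ≡ l
  toℕᴷ-injective eq = trans (sym (fromℕᴷ-toℕᴷ k)) (trans (cong fromℕᴷ eq) (fromℕᴷ-toℕᴷ l))

kinds : List Kind
kinds = X ∷ U ∷ V ∷ Y ∷ []

Unique-kinds : Unique kinds
Unique-kinds = ((λ ()) ∷ (λ ()) ∷ (λ ()) ∷ []) ∷ ((λ ()) ∷ (λ ()) ∷ []) ∷ ((λ ()) ∷ []) ∷ [] ∷ []

module DP (n t : ℕ) .{{_ : NonZero n}} where

  -- Opaque, so that comparing vertices never unfolds the arithmetic modulo n.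
  opaque
    ι : ℕ → Fin n
    ι a = fromℕ< (m%n<n a n)

    toℕ-ι : ∀ a → toℕ (ι a) ≡ a % n
    toℕ-ι a = Fin.toℕ-fromℕ< (m%n<n a n)

    add≡ι : ∀ i k → add n i k ≡ ι (toℕ i + k)
    add≡ι i k = refl

  ι-cong : ∀ {a b} → a % n ≡ b % n → ι a ≡ ι b
  ι-cong {a} {b} eq = Fin.toℕ-injective (trans (toℕ-ι a) (trans eq (sym (toℕ-ι b))))

  ι-+n : ∀ a → ι (a + n) ≡ ι a
  ι-+n a = ι-cong ([m+n]%n≡m%n a n)

  ι-wrap : ∀ c {b} → b ≡ c + n → ι b ≡ ι c
  ι-wrap c refl = ι-+n c

  ι-toℕ : ∀ i → ι (toℕ i) ≡ i
  ι-toℕ i = Fin.toℕ-injective (trans (toℕ-ι (toℕ i)) (m<n⇒m%n≡m (Fin.toℕ<n i)))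

  add-ι : ∀ a k → add n (ι a) k ≡ ι (a + k)
  add-ι a k = trans (add≡ι (ι a) k) (ι-cong (begin
    (toℕ (ι a) + k) % n     ≡⟨ cong (λ z → (z + k) % n) (toℕ-ι a) ⟩
    (a % n + k) % n         ≡⟨ %-distribˡ-+ (a % n) k n ⟩
    (a % n % n + k % n) % n ≡⟨ cong (λ z → (z + k % n) % n) (m%n%n≡m%n a n) ⟩
    (a % n + k % n) % n     ≡⟨ %-distribˡ-+ a k n ⟨
    (a + k) % n             ∎))
    where open ≡-Reasoning

  ι-+t-surjective : ∀ a → ∃ λ c → c < n × ι (c + t) ≡ ι a
  ι-+t-surjective a = c , m%n<n (a + (n ∸ t % n)) n , ι-cong (begin
    (c + t) % n                         ≡⟨ %-distribˡ-+ c t n ⟩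
    (c % n + t % n) % n                 ≡⟨ cong (λ z → (z + t % n) % n) (m%n%n≡m%n (a + (n ∸ t % n)) n) ⟩
    ((a + (n ∸ t % n)) % n + t % n) % n ≡⟨ %-distribˡ-+ (a + (n ∸ t % n)) t n ⟨
    (a + (n ∸ t % n) + t) % n           ≡⟨ cong (_% n) (+-assoc a (n ∸ t % n) t) ⟩
    (a + ((n ∸ t % n) + t)) % n         ≡⟨ cong (λ z → (a + z) % n) wrap ⟩
    (a + (n + (t / n) * n)) % n         ≡⟨ cong (_% n) (+-assoc a n ((t / n) * n)) ⟨
    (a + n + (t / n) * n) % n           ≡⟨ [m+kn]%n≡m%n (a + n) (t / n) n ⟩
    (a + n) % n                         ≡⟨ [m+n]%n≡m%n a n ⟩
    a % n                               ∎)
    where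
    open ≡-Reasoning
    c = (a + (n ∸ t % n)) % n
    wrap : (n ∸ t % n) + t ≡ n + (t / n) * n
    wrap = begin
      (n ∸ t % n) + t                     ≡⟨ cong ((n ∸ t % n) +_) (m≡m%n+[m/n]*n t n) ⟩
      (n ∸ t % n) + (t % n + (t / n) * n) ≡⟨ +-assoc (n ∸ t % n) (t % n) ((t / n) * n) ⟨
      (n ∸ t % n) + t % n + (t / n) * n   ≡⟨ cong (_+ (t / n) * n) (m∸n+n≡m (m%n≤n t n)) ⟩
      n + (t / n) * n                     ∎

  -- v and y are the shifted v′ and y′.
  x u v y : ℕ → Vertex n
  x a = X , ι a
  u a = U , ι a
  v a = V , ι (a + t)
  y a = Y , ι (a + t)

  σ : ℕ
  σ = t + t

  infix 4 _~_
  _~_ : Vertex n → Vertex n → Set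
  _~_ = Adj n t

  ~-sym : ∀ {p q} → p ~ q → q ~ p
  ~-sym (inj₁ e) = inj₂ e
  ~-sym (inj₂ e) = inj₁ e

  x~x : ∀ a → x a ~ x (suc a)
  x~x a = subst (λ i → x a ~ (X , i)) (trans (add-ι a 1) (cong ι (+-comm a 1))) (inj₁ (xx (ι a)))

  y~y : ∀ a → y a ~ y (suc a)
  y~y a = subst (λ i → y a ~ (Y , i)) (trans (add-ι (a + t) 1) (cong ι (+-comm (a + t) 1))) (inj₁ (yy (ι (a + t))))

  x~u : ∀ a → x a ~ u a
  x~u a = inj₁ (xu (ι a))

  u~v : ∀ a → u a ~ v a
  u~v a = subst (λ i → u a ~ (V , i)) (add-ι a t) (inj₁ (uv (ι a)))

  v~y : ∀ a → v a ~ y a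
  v~y a = inj₂ (yv (ι (a + t)))

  v~u : ∀ a → v a ~ u (a + σ)
  v~u a = subst (λ i → v a ~ (U , i)) (trans (add-ι (a + t) t) (cong ι (+-assoc a t t))) (inj₁ (vu (ι (a + t))))

  infixr 5 _▸_
  data Path : Vertex n → Vertex n → List (Vertex n) → Set where
    stop : ∀ {p} → Path p p [ p ]
    _▸_  : ∀ {p q r xs} → p ~ q → Path q r xs → Path p r (p ∷ xs)

  infixr 5 _++⟨_⟩_
  _++⟨_⟩_ : ∀ {p q r s xs ys} → Path p q xs → q ~ r → Path r s ys → Path p s (xs ++ ys)
  stop    ++⟨ e ⟩ π = e ▸ π
  (f ▸ ρ) ++⟨ e ⟩ π = f ▸ (ρ ++⟨ e ⟩ π)

  backwards : ∀ {p q xs} → Path p q xs → Path q p (reverse xs)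
  backwards stop = stop
  backwards {p} {xs = p ∷ xs} (e ▸ π) =
    subst (Path _ p) (sym (List.unfold-reverse p xs)) (backwards π ++⟨ ~-sym e ⟩ stop)

  cast : ∀ {p p′ q q′ xs} → p ≡ p′ → q ≡ q′ → Path p q xs → Path p′ q′ xs
  cast refl refl π = π

  Path⇒Linked : ∀ {p q xs} → Path p q xs → Linked _~_ xs
  Path⇒Linked stop           = [-]
  Path⇒Linked (e ▸ stop)     = e ∷ [-]
  Path⇒Linked (e ▸ (f ▸ π))  = e ∷ Path⇒Linked (f ▸ π)

  head-Path : ∀ {p q xs} → Path p q xs → head xs ≡ just p
  head-Path stop    = refl
  head-Path (_ ▸ _) = refl

  last-Path : ∀ {p q xs} → Path p q xs → last xs ≡ just q
  last-Path stop          = refl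
  last-Path (_ ▸ stop)    = refl
  last-Path (_ ▸ (f ▸ π)) = last-Path (f ▸ π)

  vertices : List (Vertex n)
  vertices = cartesianProduct kinds (allFin n)

  closed-Path⇒Hamiltonian : ∀ {p q xs} → Path p q xs → q ~ p → (∀ w → w ∈ xs) → length xs ≡ 4 * n →
                            Hamiltonian n t
  closed-Path⇒Hamiltonian {p} {q} {xs} π q~p covers |xs|≡4n = record
    { cycle   = xs
    ; unique  = ⊆-length≤⇒Unique (Product.≡-dec _≟ᴷ_ Fin._≟_)
                  (Unique.cartesianProduct⁺ Unique-kinds (Unique.allFin⁺ n))
                  (λ {w} _ → covers w)
                  (≤-reflexive (trans |xs|≡4n (sym |vertices|≡4n)))
    ; covers  = covers
    ; linked  = Path⇒Linked π
    ; closeA  = p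
    ; closeB  = q
    ; headEq  = head-Path π
    ; lastEq  = last-Path π
    ; closing = q~p
    }
    where
    |vertices|≡4n : length vertices ≡ 4 * n
    |vertices|≡4n = trans (length-cartesianProduct kinds (allFin n)) (cong (4 *_) (List.length-tabulate {n = n} (λ i → i)))

  covering-by-indices : ∀ {xs} → (∀ {a} → a < n → x a ∈ xs) → (∀ {a} → a < n → u a ∈ xs) →
                        (∀ {a} → a < n → v a ∈ xs) → (∀ {a} → a < n → y a ∈ xs) → ∀ w → w ∈ xs
  covering-by-indices {xs} on-x on-u on-v on-y (k , i) = from-kind k
    where
    on-+t : ∀ {K} → (∀ {a} → a < n → (K , ι (a + t)) ∈ xs) → (K , i) ∈ xs
    on-+t {K} on with ι-+t-surjective (toℕ i)
    ... | c , c<n , eq = subst (λ j → (K , j) ∈ xs) (trans eq (ι-toℕ i)) (on c<n)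
    from-kind : ∀ k → (k , i) ∈ xs
    from-kind X = subst (λ j → (X , j) ∈ xs) (ι-toℕ i) (on-x (Fin.toℕ<n i))
    from-kind U = subst (λ j → (U , j) ∈ xs) (ι-toℕ i) (on-u (Fin.toℕ<n i))
    from-kind V = on-+t on-v
    from-kind Y = on-+t on-y

  module Blocks {S E F : ℕ → Vertex n} {block final : ℕ → List (Vertex n)}
                (block-path : ∀ k → Path (S k) (E k) (block k))
                (final-path : ∀ k → Path (S k) (F k) (final k))
                (link : ∀ k → E k ~ S (suc k)) where

    blocks : ℕ → ℕ → List (Vertex n)
    blocks k zero    = final k
    blocks k (suc c) = block k ++ blocks (suc k) c

    blocks-path : ∀ k c → Path (S k) (F (k + c)) (blocks k c)
    blocks-path k zero    = cast refl (cong F (sym (+-identityʳ k))) (final-path k)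
    blocks-path k (suc c) = block-path k ++⟨ link k ⟩ cast refl (cong F (sym (+-suc k c))) (blocks-path (suc k) c)

    block⊆blocks : ∀ k {c j} → j < c → block (k + j) ⊆ blocks k c
    block⊆blocks k {suc c} {zero} _ =
      subst (λ i → block i ⊆ blocks k (suc c)) (sym (+-identityʳ k)) (xs⊆xs++ys (block k) _)
    block⊆blocks k {suc c} {suc j} (s≤s j<c) =
      subst (λ i → block i ⊆ blocks k (suc c)) (sym (+-suc k j))
        (⊆-trans (block⊆blocks (suc k) j<c) (xs⊆ys++xs _ (block k)))

    final⊆blocks : ∀ k c → final (k + c) ⊆ blocks k c
    final⊆blocks k zero = subst (λ i → final i ⊆ final k) (sym (+-identityʳ k)) (λ z∈ → z∈)
    final⊆blocks k (suc c) =
      subst (λ i → final i ⊆ blocks k (suc c)) (sym (+-suc k c))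
        (⊆-trans (final⊆blocks (suc k) c) (xs⊆ys++xs _ (block k)))

    length-blocks : ∀ {ℓ ℓ′} → (∀ k → length (block k) ≡ ℓ) → (∀ k → length (final k) ≡ ℓ′) →
                    ∀ k c → length (blocks k c) ≡ c * ℓ + ℓ′
    length-blocks |block| |final| k zero    = |final| k
    length-blocks {ℓ} {ℓ′} |block| |final| k (suc c) = begin
      length (block k ++ blocks (suc k) c)         ≡⟨ List.length-++ (block k) ⟩
      length (block k) + length (blocks (suc k) c) ≡⟨ cong₂ _+_ (|block| k) (length-blocks |block| |final| (suc k) c) ⟩
      ℓ + (c * ℓ + ℓ′)                             ≡⟨ +-assoc ℓ (c * ℓ) ℓ′ ⟨
      suc c * ℓ + ℓ′                               ∎
      where open ≡-Reasoning

  module UniformBlocks {S E : ℕ → Vertex n} {block : ℕ → List (Vertex n)}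
                       (block-path : ∀ k → Path (S k) (E k) (block k))
                       (link : ∀ k → E k ~ S (suc k)) where

    open Blocks block-path block-path link public using (blocks; blocks-path; length-blocks)
    open Blocks block-path block-path link using (block⊆blocks; final⊆blocks)

    block⊆blocks′ : ∀ k {c j} → j ≤ c → block (k + j) ⊆ blocks k c
    block⊆blocks′ k j≤c with m≤n⇒m<n∨m≡n j≤c
    ... | inj₁ j<c  = block⊆blocks k j<c
    ... | inj₂ refl = final⊆blocks k _

  module Run (f : ℕ → Vertex n) (f~f : ∀ a → f a ~ f (suc a)) where

    open UniformBlocks {S = f} {E = f} {block = λ a → [ f a ]} (λ _ → stop) f~f public
      using (blocks-path; length-blocks)
      renaming (blocks to run)
    open UniformBlocks {S = f} {E = f} {block = λ a → [ f a ]} (λ _ → stop) f~f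
      using (block⊆blocks′)

    on-run : ∀ a {c j} → j ≤ c → f (a + j) ∈ run a c
    on-run a j≤c = block⊆blocks′ a j≤c (here refl)

  module X-run = Run x x~x
  module Y-run = Run y y~y

  infix 4 _∋uv_
  _∋uv_ : List (Vertex n) → ℕ → Set
  xs ∋uv a = u a ∈ xs × v a ∈ xs

  ∋uv-⊆ : ∀ {xs ys a} → xs ⊆ ys → xs ∋uv a → ys ∋uv a
  ∋uv-⊆ xs⊆ys (u∈ , v∈) = xs⊆ys u∈ , xs⊆ys v∈

  row-bound : ∀ {d ρ j K} → d ≤ ρ → ρ + j * σ < d + K * σ → j < K
  row-bound {d} {ρ} {j} {K} d≤ρ lt =
    *-cancelʳ-< σ j K (+-cancelˡ-< d (j * σ) (K * σ) (≤-<-trans (+-monoˡ-≤ (j * σ) d≤ρ) lt))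

  column-link : ∀ q k → v (q + k * σ) ~ u (q + suc k * σ)
  column-link q k = subst (λ b → v (q + k * σ) ~ u b)
    (trans (+-assoc q (k * σ) σ) (cong (q +_) (+-comm (k * σ) σ))) (v~u (q + k * σ))

  module Column (q : ℕ) =
    UniformBlocks {S = λ k → u (q + k * σ)} {E = λ k → v (q + k * σ)} {block = λ k → u (q + k * σ) ∷ [ v (q + k * σ) ]}
                  (λ k → u~v (q + k * σ) ▸ stop) (column-link q)

  column : ℕ → ℕ → List (Vertex n)
  column K q = Column.blocks q 0 K

  column-path : ∀ K q → Path (u q) (v (q + K * σ)) (column K q)
  column-path K q = cast (cong u (+-identityʳ q)) refl (Column.blocks-path q 0 K)

  on-column : ∀ K q {j} → j ≤ K → column K q ∋uv q + j * σ
  on-column K q j≤K = Column.block⊆blocks′ q 0 j≤K (here refl) , Column.block⊆blocks′ q 0 j≤K (there (here refl))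

  length-column : ∀ K q → length (column K q) ≡ K * 2 + 2
  length-column K q = Column.length-blocks q (λ _ → refl) (λ _ → refl) 0 K

  tooth : ℕ → ℕ → List (Vertex n)
  tooth K p = x p ∷ x (1 + p) ∷ column K (1 + p) ++ y (1 + p + K * σ) ∷ y (2 + p + K * σ) ∷ reverse (column K (2 + p))

  tooth-path : ∀ K p → Path (x p) (u (2 + p)) (tooth K p)
  tooth-path K p = x~x p ▸ x~u (1 + p) ▸
    (column-path K (1 + p) ++⟨ v~y _ ⟩ (y~y _ ▸ ~-sym (v~y _) ▸ backwards (column-path K (2 + p))))

  length-tooth : ∀ K p → length (tooth K p) ≡ 2 + ((K * 2 + 2) + (2 + (K * 2 + 2)))
  length-tooth K p = cong (2 +_) (trans (List.length-++ (column K (1 + p)))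
    (cong₂ _+_ (length-column K (1 + p)) (cong (2 +_) (trans (List.length-reverse (column K (2 + p))) (length-column K (2 + p))))))

  column⊆tooth : ∀ K p → column K (1 + p) ⊆ tooth K p
  column⊆tooth K p = there ∘′ there ∘′ ∈-++⁺ˡ

  reverse-column⊆tooth : ∀ K p → reverse (column K (2 + p)) ⊆ tooth K p
  reverse-column⊆tooth K p = there ∘′ there ∘′ ∈-++⁺ʳ (column K (1 + p)) ∘′ there ∘′ there

  next-tooth : ∀ q k → u (2 + (q + (k + k))) ~ x (q + (suc k + suc k))
  next-tooth q k = subst (λ b → u (2 + (q + (k + k))) ~ x b) (sym (+-suc-suc-double q k)) (~-sym (x~u _))

  module Comb (K q : ℕ) where

    open Blocks {S = λ k → x (q + (k + k))} {E = λ k → u (2 + (q + (k + k)))} {F = λ k → x (q + (k + k))}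
                {block = λ k → tooth K (q + (k + k))} {final = λ k → [ x (q + (k + k)) ]}
                (λ k → tooth-path K (q + (k + k))) (λ _ → stop) (next-tooth q)

    comb : ℕ → List (Vertex n)
    comb = blocks 0

    comb-path : ∀ c → Path (x q) (x (q + (c + c))) (comb c)
    comb-path c = cast (cong x (+-identityʳ q)) refl (blocks-path 0 c)

    length-comb : ∀ c → length (comb c) ≡ c * (2 + ((K * 2 + 2) + (2 + (K * 2 + 2)))) + 1
    length-comb = length-blocks (λ k → length-tooth K (q + (k + k))) (λ _ → refl) 0

    tooth⊆comb : ∀ {c} k → k < c → tooth K (q + (k + k)) ⊆ comb c
    tooth⊆comb k = block⊆blocks 0

    x-at-even : ∀ {c k} → k < c ⊎ k ≡ c → x (q + (k + k)) ∈ comb c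
    x-at-even {c} {k} (inj₁ k<c) = tooth⊆comb {c} k k<c (here refl)
    x-at-even {c} (inj₂ refl)    = final⊆blocks 0 c (here refl)

    on-comb-x : ∀ {c i} → Parity i → i ≤ c + c → x (q + i) ∈ comb c
    on-comb-x {c} (even k) i≤2c = x-at-even (m≤n⇒m<n∨m≡n (m+m≤n+n⇒m≤n {k} {c} i≤2c))
    on-comb-x {c} (odd k)  i≤2c =
      subst (λ b → x b ∈ comb c) (sym (+-suc q (k + k))) (tooth⊆comb {c} k (m+m<n+n⇒m<n i≤2c) (there (here refl)))

    on-comb-uv : ∀ {c i j} → Parity i → i < c + c → j ≤ K → comb c ∋uv q + suc i + j * σ
    on-comb-uv {c} {j = j} (even k) i<2c j≤K =
      subst (λ b → comb c ∋uv b + j * σ) (sym (+-suc q (k + k)))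
        (∋uv-⊆ (tooth⊆comb {c} k (m+m<n+n⇒m<n i<2c) ∘′ column⊆tooth K (q + (k + k)))
          (on-column K (1 + (q + (k + k))) j≤K))
    on-comb-uv {c} {j = j} (odd k) i<2c j≤K =
      subst (λ b → comb c ∋uv b + j * σ) (sym (+-suc-suc q (k + k)))
        (∋uv-⊆ (tooth⊆comb {c} k (m+m≤n+n⇒m≤n (subst (_≤ c + c) (sym (double-suc k)) i<2c))
                  ∘′ reverse-column⊆tooth K (q + (k + k)))
          (∋uv-⊆ reverse⁺ (on-column K (2 + (q + (k + k))) j≤K)))

    on-comb-y : ∀ {c i} → Parity i → i < c + c → y (q + suc i + K * σ) ∈ comb c
    on-comb-y {c} (even k) i<2c =
      subst (λ b → y (b + K * σ) ∈ comb c) (sym (+-suc q (k + k)))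
        (tooth⊆comb {c} k (m+m<n+n⇒m<n i<2c) (there (there (∈-++⁺ʳ (column K (1 + (q + (k + k)))) (here refl)))))
    on-comb-y {c} (odd k) i<2c =
      subst (λ b → y (b + K * σ) ∈ comb c) (sym (+-suc-suc q (k + k)))
        (tooth⊆comb {c} k (m+m≤n+n⇒m≤n (subst (_≤ c + c) (sym (double-suc k)) i<2c))
          (there (there (∈-++⁺ʳ (column K (1 + (q + (k + k)))) (there (here refl))))))

module EvenCycle (m t : ℕ) where

  open DP (suc m + suc m) t

  rung-pair : ℕ → List (Vertex (suc m + suc m))
  rung-pair k = x a ∷ u a ∷ v a ∷ y a ∷ y (suc a) ∷ v (suc a) ∷ u (suc a) ∷ [ x (suc a) ]
    where a = k + k

  rung-pair-path : ∀ k → Path (x (k + k)) (x (suc (k + k))) (rung-pair k)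
  rung-pair-path k =
    x~u a ▸ u~v a ▸ v~y a ▸ y~y a ▸ ~-sym (v~y (suc a)) ▸ ~-sym (u~v (suc a)) ▸ ~-sym (x~u (suc a)) ▸ stop
    where a = k + k

  next-pair : ∀ k → x (suc (k + k)) ~ x (suc k + suc k)
  next-pair k = subst (λ b → x (suc (k + k)) ~ x b) (cong suc (sym (+-suc k k))) (x~x (suc (k + k)))

  open UniformBlocks rung-pair-path next-pair

  cycle-closes : x (suc (m + m)) ~ x 0
  cycle-closes = subst (λ i → x (suc (m + m)) ~ (X , i))
                    (trans (cong ι (cong suc (sym (+-suc m m)))) (ι-+n 0)) (x~x (suc (m + m)))

  on-ladder : (f : ℕ → Vertex (suc m + suc m)) →
              (∀ k → f (k + k) ∈ rung-pair k) → (∀ k → f (suc (k + k)) ∈ rung-pair k) →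
              ∀ {a} → Parity a → a < suc m + suc m → f a ∈ blocks 0 m
  on-ladder f at-even at-odd (even k) a<n = block⊆blocks′ 0 {j = k} (s≤s⁻¹ (m+m<n+n⇒m<n a<n)) (at-even k)
  on-ladder f at-even at-odd (odd k)  a<n = block⊆blocks′ 0 {j = k} (s≤s⁻¹ (m+m<n+n⇒m<n (<⇒≤ a<n))) (at-odd k)

  hamiltonian : Hamiltonian (suc m + suc m) t
  hamiltonian = closed-Path⇒Hamiltonian (blocks-path 0 m) cycle-closes
    (covering-by-indices
      (on-ladder x (λ _ → here refl) (λ _ → there (there (there (there (there (there (there (here refl)))))))) (parity _))
      (on-ladder u (λ _ → there (here refl)) (λ _ → there (there (there (there (there (there (here refl))))))) (parity _))
      (on-ladder v (λ _ → there (there (here refl))) (λ _ → there (there (there (there (there (here refl)))))) (parity _))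
      (on-ladder y (λ _ → there (there (there (here refl)))) (λ _ → there (there (there (there (here refl))))) (parity _)))
    (trans (length-blocks (λ _ → refl) (λ _ → refl) 0 m) (8m+8≡4[2m+2] m))
    where
    8m+8≡4[2m+2] : ∀ m → m * 8 + 8 ≡ 4 * (suc m + suc m)
    8m+8≡4[2m+2] = solve-∀

module OddCycle-2t+1 (s : ℕ) where

  open DP (suc (suc s + suc s)) (suc s)

  v~u-pred : ∀ a → v (suc a) ~ u a
  v~u-pred a = subst (λ i → v (suc a) ~ (U , i)) (trans (cong ι (sym (+-suc a σ))) (ι-+n a)) (v~u (suc a))

  opening : ℕ → List (Vertex (suc σ))
  opening k = x c ∷ x (1 + c) ∷ u (1 + c) ∷ v (2 + c) ∷ [ y (2 + c) ]
    where c = k + k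

  block final : ℕ → List (Vertex (suc σ))
  block k = opening k ++ y (3 + c) ∷ v (3 + c) ∷ [ u (2 + c) ]
    where c = k + k
  final k = opening k ++ y (3 + c) ∷ y (4 + c) ∷ [ v (4 + c) ]
    where c = k + k

  opening-path : ∀ k → Path (x (k + k)) (y (2 + (k + k))) (opening k)
  opening-path k = x~x c ▸ x~u (1 + c) ▸ ~-sym (v~u-pred (1 + c)) ▸ v~y (2 + c) ▸ stop
    where c = k + k

  block-path : ∀ k → Path (x (k + k)) (u (2 + (k + k))) (block k)
  block-path k = opening-path k ++⟨ y~y (2 + c) ⟩ (~-sym (v~y (3 + c)) ▸ v~u-pred (2 + c) ▸ stop)
    where c = k + k

  final-path : ∀ k → Path (x (k + k)) (v (4 + (k + k))) (final k)
  final-path k = opening-path k ++⟨ y~y (2 + c) ⟩ (y~y (3 + c) ▸ ~-sym (v~y (4 + c)) ▸ stop)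
    where c = k + k

  next-block : ∀ k → u (2 + (k + k)) ~ x (suc k + suc k)
  next-block k = subst (λ b → u (2 + (k + k)) ~ x b) (sym (double-suc k)) (~-sym (x~u (2 + (k + k))))

  open Blocks block-path final-path next-block

  prelude : List (Vertex (suc σ))
  prelude = u 0 ∷ v 0 ∷ u σ ∷ [ x σ ]

  cycle : List (Vertex (suc σ))
  cycle = prelude ++ blocks 0 s

  cycle-path : Path (u 0) (v (4 + (s + s))) cycle
  cycle-path = (u~v 0 ▸ v~u 0 ▸ ~-sym (x~u σ) ▸ stop)
    ++⟨ subst (λ i → x σ ~ (X , i)) (ι-+n 0) (x~x σ) ⟩ blocks-path 0 s

  cycle-closes : v (4 + (s + s)) ~ u 0
  cycle-closes = subst (λ i → v (4 + (s + s)) ~ (U , i))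
    (trans (ι-wrap (suc σ) (4+2s+σ≡n+n s)) (ι-+n 0)) (v~u (4 + (s + s)))
    where
    4+2s+σ≡n+n : ∀ s → 4 + (s + s) + (suc s + suc s) ≡ suc (suc s + suc s) + suc (suc s + suc s)
    4+2s+σ≡n+n = solve-∀

  -- The indices 3 + 2s and 4 + 2s of the final block wrap around to 0 and 1.
  ι-3+2s+t : ι (3 + (s + s) + suc s) ≡ ι (0 + suc s)
  ι-3+2s+t = ι-wrap (0 + suc s) (3+2s+t≡t+n s)
    where
    3+2s+t≡t+n : ∀ s → 3 + (s + s) + suc s ≡ 0 + suc s + suc (suc s + suc s)
    3+2s+t≡t+n = solve-∀

  ι-4+2s+t : ι (4 + (s + s) + suc s) ≡ ι (1 + suc s)
  ι-4+2s+t = ι-wrap (1 + suc s) (4+2s+t≡1+t+n s)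
    where
    4+2s+t≡1+t+n : ∀ s → 4 + (s + s) + suc s ≡ 1 + suc s + suc (suc s + suc s)
    4+2s+t≡1+t+n = solve-∀

  on-block : ∀ k → k < s → block k ⊆ cycle
  on-block k k<s = ⊆-trans (block⊆blocks 0 k<s) (xs⊆ys++xs _ prelude)

  on-final : final s ⊆ cycle
  on-final = ⊆-trans (final⊆blocks 0 s) (xs⊆ys++xs _ prelude)

  on-opening : ∀ {k} → k < s ⊎ k ≡ s → opening k ⊆ cycle
  on-opening {k} (inj₁ k<s) = ⊆-trans (xs⊆xs++ys (opening k) _) (on-block k k<s)
  on-opening     (inj₂ refl) = ⊆-trans (xs⊆xs++ys (opening s) _) on-final

  on-opening′ : ∀ k → k ≤ s → opening k ⊆ cycle
  on-opening′ k k≤s = on-opening (m≤n⇒m<n∨m≡n k≤s)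

  covers-x : ∀ {a} → a < σ ⊎ a ≡ σ → Parity a → x a ∈ cycle
  covers-x (inj₂ refl) _        = there (there (there (here refl)))
  covers-x (inj₁ a<σ)  (even k) = on-opening′ k (s≤s⁻¹ (m+m<n+n⇒m<n a<σ)) (here refl)
  covers-x (inj₁ a<σ)  (odd k)  = on-opening′ k (s≤s⁻¹ (m+m<n+n⇒m<n (<⇒≤ a<σ))) (there (here refl))

  u-at-even : ∀ {k} → k < s ⊎ k ≡ s → u (suc k + suc k) ∈ cycle
  u-at-even {k} (inj₁ k<s) = subst (_∈ cycle) (cong u (sym (double-suc k)))
                               (on-block k k<s (there (there (there (there (there (there (there (here refl)))))))))
  u-at-even (inj₂ refl)    = there (there (here refl))

  covers-u : ∀ {a} → Parity a → a < suc σ → u a ∈ cycle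
  covers-u (even zero)    _   = here refl
  covers-u (even (suc k)) a<n = u-at-even (m≤n⇒m<n∨m≡n (s≤s⁻¹ (m+m≤n+n⇒m≤n (s≤s⁻¹ a<n))))
  covers-u (odd k)        a<n = on-opening′ k (s≤s⁻¹ (m+m<n+n⇒m<n (s≤s⁻¹ a<n))) (there (there (here refl)))

  covers-v : ∀ {a} → Parity a → a < suc σ → v a ∈ cycle
  covers-v (even zero)    _   = there (here refl)
  covers-v (odd zero)     _   = subst (_∈ cycle) (cong (V ,_) ι-4+2s+t)
                                  (on-final (there (there (there (there (there (there (there (here refl)))))))))
  covers-v (even (suc k)) a<n = subst (_∈ cycle) (cong v (sym (double-suc k)))
                                  (on-opening′ k (s≤s⁻¹ (m+m≤n+n⇒m≤n (s≤s⁻¹ a<n))) (there (there (there (here refl)))))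
  covers-v (odd (suc k))  a<n = subst (_∈ cycle) (cong (v ∘′ suc) (sym (double-suc k)))
                                  (on-block k (s≤s⁻¹ (m+m<n+n⇒m<n (s≤s⁻¹ a<n)))
                                    (there (there (there (there (there (there (here refl))))))))

  covers-y : ∀ {a} → Parity a → a < suc σ → y a ∈ cycle
  covers-y (even zero)    _   = subst (_∈ cycle) (cong (Y ,_) ι-3+2s+t)
                                  (on-final (there (there (there (there (there (here refl)))))))
  covers-y (odd zero)     _   = subst (_∈ cycle) (cong (Y ,_) ι-4+2s+t)
                                  (on-final (there (there (there (there (there (there (here refl))))))))
  covers-y (even (suc k)) a<n = subst (_∈ cycle) (cong y (sym (double-suc k)))
                                  (on-opening′ k (s≤s⁻¹ (m+m≤n+n⇒m≤n (s≤s⁻¹ a<n))) (there (there (there (there (here refl))))))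
  covers-y (odd (suc k))  a<n = subst (_∈ cycle) (cong (y ∘′ suc) (sym (double-suc k)))
                                  (on-block k (s≤s⁻¹ (m+m<n+n⇒m<n (s≤s⁻¹ a<n)))
                                    (there (there (there (there (there (here refl)))))))

  hamiltonian : Hamiltonian (suc σ) (suc s)
  hamiltonian = closed-Path⇒Hamiltonian cycle-path cycle-closes
    (covering-by-indices (λ a<n → covers-x (m<1+n⇒m<n∨m≡n a<n) (parity _))
      (covers-u (parity _)) (covers-v (parity _)) (covers-y (parity _)))
    (trans (cong (4 +_) (length-blocks (λ _ → refl) (λ _ → refl) 0 s)) (4+[8s+8]≡4n s))
    where
    4+[8s+8]≡4n : ∀ s → 4 + (s * 8 + 8) ≡ 4 * suc (suc s + suc s)
    4+[8s+8]≡4n = solve-∀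

module OddCycle (e r M : ℕ) where

  ℓ N : ℕ
  ℓ = suc (e + e)
  N = ℓ + suc M * ((suc e + r) + (suc e + r))

  open DP (suc (suc N)) (suc e + r)

  σ-split : suc ℓ + (r + r) ≡ σ
  σ-split = identity e r
    where
    identity : ∀ e r → suc (suc (e + e)) + (r + r) ≡ (suc e + r) + (suc e + r)
    identity = solve-∀

  module Right = Comb M (suc ℓ)
  module Left  = Comb (suc M) 0

  seg-y col-ℓ+1 seg-x corner col-ℓ comb-left cycle : List (Vertex (suc (suc N)))
  seg-y     = u 0 ∷ v 0 ∷ Y-run.run 0 (suc ℓ + M * σ)
  col-ℓ+1   = reverse (column M (suc ℓ))
  seg-x     = X-run.run (suc σ) (ℓ + M * σ)
  corner    = u (suc N) ∷ v (suc N) ∷ y (suc N) ∷ [ y N ]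
  col-ℓ     = reverse (column (suc M) ℓ)
  comb-left = reverse (Left.comb e ++ [ x ℓ ])
  cycle     = seg-y ++ col-ℓ+1 ++ Right.comb r ++ seg-x ++ corner ++ col-ℓ ++ comb-left

  x-stretch-end : suc σ + (ℓ + M * σ) ≡ suc N
  x-stretch-end = identity ℓ σ M
    where
    identity : ∀ ℓ σ M → suc σ + (ℓ + M * σ) ≡ suc (ℓ + suc M * σ)
    identity = solve-∀

  cycle-path : Path (u 0) (x 0) cycle
  cycle-path =
    (u~v 0 ▸ v~y 0 ▸ Y-run.blocks-path 0 (suc ℓ + M * σ))
    ++⟨ ~-sym (v~y (suc ℓ + M * σ)) ⟩ backwards (column-path M (suc ℓ))
    ++⟨ ~-sym (x~u (suc ℓ)) ⟩ Right.comb-path r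
    ++⟨ subst (λ b → x (suc ℓ + (r + r)) ~ x (suc b)) σ-split (x~x (suc ℓ + (r + r))) ⟩
        cast refl (cong x x-stretch-end) (X-run.blocks-path (suc σ) (ℓ + M * σ))
    ++⟨ x~u (suc N) ⟩ (u~v (suc N) ▸ v~y (suc N) ▸ ~-sym (y~y N) ▸ stop)
    ++⟨ ~-sym (v~y N) ⟩ backwards (column-path (suc M) ℓ)
    ++⟨ ~-sym (x~u ℓ) ⟩ backwards (Left.comb-path e ++⟨ x~x (e + e) ⟩ stop)

  in-seg-y : seg-y ⊆ cycle
  in-seg-y = ∈-++⁺ˡ

  in-col-ℓ+1 : col-ℓ+1 ⊆ cycle
  in-col-ℓ+1 = ∈-++⁺ʳ seg-y ∘′ ∈-++⁺ˡ

  in-comb-right : Right.comb r ⊆ cycle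
  in-comb-right = ∈-++⁺ʳ seg-y ∘′ ∈-++⁺ʳ col-ℓ+1 ∘′ ∈-++⁺ˡ

  in-seg-x : seg-x ⊆ cycle
  in-seg-x = ∈-++⁺ʳ seg-y ∘′ ∈-++⁺ʳ col-ℓ+1 ∘′ ∈-++⁺ʳ (Right.comb r) ∘′ ∈-++⁺ˡ

  in-corner : corner ⊆ cycle
  in-corner = ∈-++⁺ʳ seg-y ∘′ ∈-++⁺ʳ col-ℓ+1 ∘′ ∈-++⁺ʳ (Right.comb r) ∘′ ∈-++⁺ʳ seg-x ∘′ ∈-++⁺ˡ

  in-col-ℓ : col-ℓ ⊆ cycle
  in-col-ℓ = ∈-++⁺ʳ seg-y ∘′ ∈-++⁺ʳ col-ℓ+1 ∘′ ∈-++⁺ʳ (Right.comb r) ∘′ ∈-++⁺ʳ seg-x ∘′ ∈-++⁺ʳ corner ∘′ ∈-++⁺ˡ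

  in-comb-left : comb-left ⊆ cycle
  in-comb-left = ∈-++⁺ʳ seg-y ∘′ ∈-++⁺ʳ col-ℓ+1 ∘′ ∈-++⁺ʳ (Right.comb r) ∘′ ∈-++⁺ʳ seg-x ∘′ ∈-++⁺ʳ corner ∘′ ∈-++⁺ʳ col-ℓ

  x-stretch-start : ∀ d → suc (ℓ + suc ((r + r) + d)) ≡ suc σ + d
  x-stretch-start d = trans (identity ℓ (r + r) d) (cong (λ b → suc b + d) σ-split)
    where
    identity : ∀ ℓ ρ d → suc (ℓ + suc (ρ + d)) ≡ suc (suc ℓ + ρ) + d
    identity = solve-∀

  covers-x-right : ∀ {d} → Cut (r + r) d → suc (ℓ + d) < suc (suc N) → x (suc (ℓ + d)) ∈ cycle
  covers-x-right {d} (below d≤2r) _ = in-comb-right (Right.on-comb-x {r} (parity d) d≤2r)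
  covers-x-right (above d)   a<n =
    in-seg-x (subst (λ b → x b ∈ seg-x) (sym (x-stretch-start d))
      (X-run.on-run (suc σ) {ℓ + M * σ} (+-cancelˡ-≤ (suc σ) d (ℓ + M * σ)
        (subst₂ _≤_ (x-stretch-start d) (sym x-stretch-end) (s≤s⁻¹ a<n)))))

  covers-x : ∀ {a} → Around ℓ a → a < suc (suc N) → x a ∈ cycle
  covers-x {a} (before a<ℓ) _ = in-comb-left (reverse⁺ (∈-++⁺ˡ (Left.on-comb-x {e} (parity a) (s≤s⁻¹ a<ℓ))))
  covers-x at           _   = in-comb-left (reverse⁺ (∈-++⁺ʳ (Left.comb e) (here refl)))
  covers-x (after d)    a<n = covers-x-right (cut (r + r) d) a<n

  ℓ≤σ : ℓ ≤ σ
  ℓ≤σ = ≤-trans (n≤1+n ℓ) (≤-trans (m≤m+n (suc ℓ) (r + r)) (≤-reflexive σ-split))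

  rows≤1+M : ∀ ρ j → ρ + j * σ < N → j ≤ suc M
  rows≤1+M ρ j lt = s≤s⁻¹ (row-bound {ρ = ρ} {j} z≤n (<-≤-trans lt (+-monoˡ-≤ (suc M * σ) ℓ≤σ)))

  -- Columns 1 … 2e lie in the left comb, columns 2e + 1 and 2e + 2 are traversed on
  -- their own, and columns 2e + 3 … 2t lie in the right comb.
  on-column-at : ∀ {ρ} j → Around (e + e) ρ → ρ < σ → ρ + j * σ < N → cycle ∋uv suc ρ + j * σ
  on-column-at {ρ} j (before ρ<2e) _ lt =
    ∋uv-⊆ (in-comb-left ∘′ reverse⁺ ∘′ ∈-++⁺ˡ) (Left.on-comb-uv {e} (parity ρ) ρ<2e (rows≤1+M ρ j lt))
  on-column-at j at _ lt =
    ∋uv-⊆ (in-col-ℓ ∘′ reverse⁺) (on-column (suc M) ℓ (rows≤1+M (e + e) j lt))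
  on-column-at j (after zero) _ lt =
    subst (λ b → cycle ∋uv suc (suc b) + j * σ) (sym (+-identityʳ (e + e)))
      (∋uv-⊆ (in-col-ℓ+1 ∘′ reverse⁺)
        (on-column M (suc ℓ) (s≤s⁻¹ (row-bound {ρ = suc (e + e + 0)} {j} (s≤s (m≤m+n (e + e) 0)) lt))))
  on-column-at j (after (suc i)) ρ<σ lt =
    ∋uv-⊆ in-comb-right
      (Right.on-comb-uv {r} (parity i) i<2r (s≤s⁻¹ (row-bound {ρ = suc (e + e + suc i)} {j} (s≤s (m≤m+n (e + e) (suc i))) lt)))
    where
    i<2r : i < r + r
    i<2r = +-cancelˡ-≤ (e + e) (suc i) (r + r) (s≤s⁻¹ (s≤s⁻¹ (subst (suc (suc (e + e + suc i)) ≤_) (sym σ-split) ρ<σ)))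

  -- u (1 + a) and v (1 + a) lie in row j of column 1 + ρ, where a = ρ + j σ with ρ < σ.
  on-columns : ∀ a → a < N → cycle ∋uv suc a
  on-columns a a<N = subst (λ b → cycle ∋uv suc b) (sym a≡ρ+jσ)
    (on-column-at (a / σ) (around (e + e) (a % σ)) (m%n<n a σ) (subst (_< N) a≡ρ+jσ a<N))
    where
    a≡ρ+jσ : a ≡ a % σ + a / σ * σ
    a≡ρ+jσ = m≡m%n+[m/n]*n a σ

  covers-uv : ∀ {a} → a < suc (suc N) → cycle ∋uv a
  covers-uv {zero}  _   = here refl , there (here refl)
  covers-uv {suc a} a<n = on-columns-or-corner (m<1+n⇒m<n∨m≡n (s≤s⁻¹ a<n))
    where
    on-columns-or-corner : ∀ {a} → a < N ⊎ a ≡ N → cycle ∋uv suc a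
    on-columns-or-corner (inj₁ a<N) = on-columns _ a<N
    on-columns-or-corner (inj₂ refl) = ∋uv-⊆ in-corner (here refl , there (here refl))

  y-right : ∀ d → suc (suc ℓ + M * σ + d) ≡ suc ℓ + suc d + M * σ
  y-right d = identity ℓ σ M d
    where
    identity : ∀ ℓ σ M d → suc (suc ℓ + M * σ + d) ≡ suc ℓ + suc d + M * σ
    identity = solve-∀

  y-left : ∀ d → suc (suc ℓ + M * σ + (r + r + d)) ≡ suc d + suc M * σ
  y-left d = subst (λ s → suc (suc ℓ + M * s + (r + r + d)) ≡ suc d + suc M * s) σ-split (identity ℓ (r + r) M d)
    where
    identity : ∀ ℓ ρ M d → suc (suc ℓ + M * (suc ℓ + ρ) + (ρ + d)) ≡ suc d + suc M * (suc ℓ + ρ)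
    identity = solve-∀

  y-corner : ∀ d → suc (suc ℓ + M * σ + (r + r + (e + e + d))) ≡ d + N
  y-corner d = trans (y-left (e + e + d)) (identity (e + e) d (suc M * σ))
    where
    identity : ∀ a d b → suc (a + d) + b ≡ d + (suc a + b)
    identity = solve-∀

  covers-y-left : ∀ {d} → Cut (e + e) (suc d) → suc (suc ℓ + M * σ + (r + r + d)) < suc (suc N) →
                  y (suc (suc ℓ + M * σ + (r + r + d))) ∈ cycle
  covers-y-left {d} (below d<2e) _ = in-comb-left (reverse⁺ (∈-++⁺ˡ
    (subst (λ b → y b ∈ Left.comb e) (sym (y-left d)) (Left.on-comb-y {e} (parity d) d<2e))))
  covers-y-left (above zero)       _ = in-corner (subst (λ b → y b ∈ corner) (sym (y-corner 0)) (there (there (there (here refl)))))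
  covers-y-left (above (suc zero)) _ = in-corner (subst (λ b → y b ∈ corner) (sym (y-corner 1)) (there (there (here refl))))
  covers-y-left (above (suc (suc d))) a<n =
    contradiction (subst (_< suc (suc N)) (y-corner (suc (suc d))) a<n) (≤⇒≯ (s≤s (s≤s (m≤n+m N d))))

  covers-y-right : ∀ {d} → Cut (r + r) (suc d) → suc (suc ℓ + M * σ + d) < suc (suc N) →
                   y (suc (suc ℓ + M * σ + d)) ∈ cycle
  covers-y-right {d} (below d<2r) _ =
    in-comb-right (subst (λ b → y b ∈ Right.comb r) (sym (y-right d)) (Right.on-comb-y {r} (parity d) d<2r))
  covers-y-right (above d) a<n = covers-y-left (cut (e + e) (suc d)) a<n

  covers-y : ∀ {a} → Cut (suc ℓ + M * σ) a → a < suc (suc N) → y a ∈ cycle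
  covers-y (below a≤) _   = in-seg-y (there (there (Y-run.on-run 0 {suc ℓ + M * σ} a≤)))
  covers-y (above d)  a<n = covers-y-right (cut (r + r) (suc d)) a<n

  length-cycle : length cycle ≡ 4 * suc (suc N)
  length-cycle = trans
    (length-++-≡ seg-y     (cong (2 +_) (Y-run.length-blocks (λ _ → refl) (λ _ → refl) 0 (suc ℓ + M * σ)))
    (length-++-≡ col-ℓ+1   (trans (List.length-reverse (column M (suc ℓ))) (length-column M (suc ℓ)))
    (length-++-≡ (Right.comb r) (Right.length-comb r)
    (length-++-≡ seg-x     (X-run.length-blocks (λ _ → refl) (λ _ → refl) (suc σ) (ℓ + M * σ))
    (length-++-≡ corner {ys = col-ℓ ++ comb-left} refl
    (length-++-≡ col-ℓ {ys = comb-left} (trans (List.length-reverse (column (suc M) ℓ)) (length-column (suc M) ℓ))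
                           (trans (List.length-reverse (Left.comb e ++ [ x ℓ ]))
                                  (length-++-≡ (Left.comb e) {ys = [ x ℓ ]} (Left.length-comb e) refl))))))))
    (identity e r M)
    where
    identity : ∀ e r M →
      let ℓ = suc (e + e); σ = (suc e + r) + (suc e + r)
          tooth = 2 + ((M * 2 + 2) + (2 + (M * 2 + 2))); tooth′ = 2 + ((suc M * 2 + 2) + (2 + (suc M * 2 + 2)))
      in (2 + ((suc ℓ + M * σ) * 1 + 1)) + ((M * 2 + 2) + ((r * tooth + 1) + (((ℓ + M * σ) * 1 + 1) +
           (4 + ((suc M * 2 + 2) + ((e * tooth′ + 1) + 1)))))) ≡ 4 * suc (suc (ℓ + suc M * σ))
    identity = solve-∀

  hamiltonian : Hamiltonian (suc (suc N)) (suc e + r)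
  hamiltonian = closed-Path⇒Hamiltonian cycle-path (x~u 0)
    (covering-by-indices (covers-x (around ℓ _)) (proj₁ ∘′ covers-uv) (proj₂ ∘′ covers-uv) (covers-y (cut _ _)))
    length-cycle

odd-shape : ∀ {b t} .{{_ : NonZero t}} → t < b →
            ∃ λ e → ∃ λ r → ∃ λ M → b ≡ suc (e + suc M * (suc e + r)) × t ≡ suc e + r
odd-shape {suc b′} {t} (s≤s t≤b′) with b′ % t | b′ / t | m%n<n b′ t | m≡m%n+[m/n]*n b′ t
... | e | zero  | e<t | refl = contradiction (≤-trans t≤b′ (≤-reflexive (+-identityʳ e))) (<⇒≱ e<t)
... | e | suc M | e<t | refl with m≤n⇒∃[o]m+o≡n e<t
...   | r , refl = e , r , M , refl , refl

Hamiltonian-cong : ∀ {n n′ t t′} .{{_ : NonZero n}} .{{_ : NonZero n′}} →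
                   n ≡ n′ → t ≡ t′ → Hamiltonian n′ t′ → Hamiltonian n t
Hamiltonian-cong refl refl h = h

odd-hamiltonian : ∀ {b t} .{{_ : NonZero t}} → t < b → Hamiltonian (suc (b + b)) t
odd-hamiltonian t<b =
  let e , r , M , b≡ , t≡ = odd-shape t<b
  in Hamiltonian-cong (trans (cong (λ b → suc (b + b)) b≡) (identity e r M)) t≡ (OddCycle.hamiltonian e r M)
  where
  identity : ∀ e r M → let t = suc e + r; b = suc (e + suc M * t) in
             suc (b + b) ≡ suc (suc (suc (e + e) + suc M * (t + t)))
  identity = solve-∀

2*m<1+n+n⇒m≤n : ∀ {m n} → 2 * m < suc (n + n) → m ≤ n
2*m<1+n+n⇒m≤n {m} {n} lt = m+m≤n+n⇒m≤n (subst (_≤ n + n) (cong (m +_) (+-identityʳ m)) (s≤s⁻¹ lt))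

theorem1 : (n t : ℕ) → .{{_ : NonZero n}} → 3 ≤ n → 2 ≤ 2 * t → 2 * t < n → Hamiltonian n t
theorem1 n zero    _   ()  _
theorem1 n (suc s) 3≤n _ 2t<n with parity n
... | even zero    = contradiction 3≤n λ ()
... | even (suc m) = EvenCycle.hamiltonian m (suc s)
... | odd b with m≤n⇒m<n∨m≡n (2*m<1+n+n⇒m≤n {n = b} 2t<n)
...   | inj₁ t<b  = odd-hamiltonian t<b
...   | inj₂ refl = OddCycle-2t+1.hamiltonian s
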